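{- Let $n\ge k>r\ge 2$ be integers and let $L\subseteq\{0,1,\ldots,\binom{k}{r}\}$ be a $3$-good list. Then $$f(n,r,k,L)\le 2^{2kn^{r-1}+n^{r-1}\log n}.$$
   Context: An $r$-graph is an $r$-uniform hypergraph. For a list $L\subseteq\{0,1,\ldots,\binom{k}{r}\}$, an $r$-graph $G$ is $(L,k)$-free if for every $i\in L$ there is no set of $k$ vertices of $G$ spanning exactly $i$ edges. $f(n,r,k,L)$ denotes the number of $(L,k)$-free $r$-graphs on the vertex set $[n]=\{1,\ldots,n\}$. A list $L$ is $3$-good if $\{i,i+1,i+2\}\cap L\neq\emptyset$ for all $i\in\{0,1,\ldots,\binom{k}{r}-2\}$, i.e. the complement of $L$ in $\{0,\ldots,\binom{k}{r}\}$ contains no $3$ consecutive integers. Logarithms are in base $2$. -}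

module Defs where

open import Data.Nat using (ℕ; zero; suc; _+_; _*_; _∸_; _^_; _≤_; _≟_)
open import Data.Nat.Combinatorics using (_C_)
open import Data.Fin.Subset using (Subset; outside; inside; ∣_∣; _⊆_)
open import Data.Fin.Subset.Properties using (_⊆?_)
open import Data.List using (List; []; _∷_; [_]; _++_; map; filter; length)
open import Data.List.Relation.Unary.All using (All; all?)
open import Data.Vec using (_∷_; [])
open import Data.List.Membership.DecPropositional _≟_ using (_∉_; _∈_; _∈?_)
open import Relation.Nullary using (¬_; Dec)
open import Relation.Nullary.Decidable using (¬?)
open import Data.Sum using (_⊎_)

allSubsets : (n : ℕ) → List (Subset n)
allSubsets zero = [ [] ]
allSubsets (suc n) = map (outside ∷_) (allSubsets n) ++ map (inside ∷_) (allSubsets n)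

subsetsOfSize : (n r : ℕ) → List (Subset n)
subsetsOfSize n r = filter (λ s → ∣ s ∣ ≟ r) (allSubsets n)

sublists : {A : Set} → List A → List (List A)
sublists [] = [ [] ]
sublists (x ∷ xs) = sublists xs ++ map (x ∷_) (sublists xs)

-- An r-graph on [n] is a set of r-subsets of [n]; we represent it by its edge
-- list, a sublist of the canonical list  subsetsOfSize n r .  Hence the
-- r-graphs on [n] correspond bijectively to  sublists (subsetsOfSize n r).
RGraphs : (n r : ℕ) → List (List (Subset n))
RGraphs n r = sublists (subsetsOfSize n r)

spanned : {n : ℕ} → List (Subset n) → Subset n → ℕ
spanned G K = length (filter (λ e → e ⊆? K) G)

LkFree : {n : ℕ} → (L : List ℕ) (k : ℕ) → List (Subset n) → Set
LkFree {n} L k G = All (λ K → spanned G K ∉ L) (subsetsOfSize n k)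

LkFree? : {n : ℕ} → (L : List ℕ) (k : ℕ) → (G : List (Subset n)) → Dec (LkFree L k G)
LkFree? {n} L k G = all? (λ K → ¬? (spanned G K ∈? L)) (subsetsOfSize n k)

f : (n r k : ℕ) → List ℕ → ℕ
f n r k L = length (filter (LkFree? L k) (RGraphs n r))

ListIn : (k r : ℕ) → List ℕ → Set
ListIn k r L = All (_≤ k C r) L

ThreeGood : (k r : ℕ) → List ℕ → Set
ThreeGood k r L = ∀ i → i + 2 ≤ k C r → (i ∈ L) ⊎ (suc i ∈ L) ⊎ (suc (suc i) ∈ L)

-- Delete one vertex v at a time. An r-graph on [m+1] is a pair: the edges avoiding v, an r-graph a
-- on [m], and the link of v, an (r-1)-graph b on [m]. A k-set avoiding v sees only a, while a k-set
-- K + v sees the edges of a inside K, a fixed offset once a is chosen, plus the edges of b inside K.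
-- So, for counts of graphs that are free relative to an arbitrary offset, the number of graphs is at
-- most the number of admissible a times the largest number of admissible links, and induction on r
-- and m gives D^(m^(r-1)) with D = 2^(2k) n, provided vertex sets (r = 1) are bounded by D.
-- For vertex sets 3-goodness does the work: v can be both in and out only if the rest of the set is
-- free for the forbidden set F ∪ (F - 1) on the sets through v. No two consecutive values avoid
-- F ∪ (F - 1), so for it every vertex is forced on 1-sets, and each further element of the sets at
-- most doubles the count; altogether at most 1 + m 2^(k-2) vertex sets are free.

module Submission where

open import Defs
open import Data.Bool using (Bool; true; false; _∧_; _∨_; not)
open import Data.Bool.ListAction using (all)
open import Data.Bool.Properties using (∧-assoc; ∧-identityʳ; ∧-zeroʳ; ∨-zeroʳ)
open import Data.Fin.Subset using (Subset; Side; outside; inside; ∣_∣; ⊥)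
open import Data.Fin.Subset.Properties using (_⊆?_; ⊥⊆; ∣⊥∣≡0)
open import Data.List using (List; []; _∷_; [_]; _++_; map; filter; length)
open import Data.List.Properties using (length-++; length-map; filter-++; ++-identityʳ)
open import Data.List.Relation.Binary.Sublist.Propositional using (_⊆_; []; _∷_; _∷ʳ_)
open import Data.List.Relation.Binary.Sublist.Propositional.Properties using (filter⁺; length-mono-≤)
open import Data.List.Relation.Unary.All using (all?)
open import Data.Vec using ([]; _∷_)
open import Data.Nat
open import Data.Nat.Properties
open import Data.List.Membership.DecPropositional _≟_ using (_∈?_)
open import Data.Nat.Combinatorics using (_C_; nC1≡n; nCk+nC[k+1]≡[n+1]C[k+1])
open import Data.Nat.Tactic.RingSolver using (solve-∀)
open import Data.Sum using (inj₁; inj₂)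
open import Function using (_∘_; id)
open import Data.Empty using (⊥-elim)
open import Relation.Nullary using (does; yes; no; ¬?)
open import Relation.Nullary.Decidable using (dec-true)
open import Relation.Unary using (Decidable)
open import Relation.Binary.PropositionalEquality hiding ([_])

private
  variable
    A B : Set
    m : ℕ

⟦_⟧ : Bool → ℕ
⟦ true ⟧ = 1
⟦ false ⟧ = 0

⟦⟧≤1 : ∀ x → ⟦ x ⟧ ≤ 1
⟦⟧≤1 true = ≤-refl
⟦⟧≤1 false = z≤n

⟦∧⟧≡⟦⟧*⟦⟧ : ∀ x y → ⟦ x ∧ y ⟧ ≡ ⟦ x ⟧ * ⟦ y ⟧
⟦∧⟧≡⟦⟧*⟦⟧ true y = sym (+-identityʳ ⟦ y ⟧)
⟦∧⟧≡⟦⟧*⟦⟧ false y = refl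

⟦⟧*n≤n : ∀ x n → ⟦ x ⟧ * n ≤ n
⟦⟧*n≤n true n = ≤-reflexive (+-identityʳ n)
⟦⟧*n≤n false n = z≤n

⟦⟧*n≤⟦⟧ : ∀ x {n} → n ≤ 1 → ⟦ x ⟧ * n ≤ ⟦ x ⟧
⟦⟧*n≤⟦⟧ true {n} n≤1 = ≤-trans (≤-reflexive (+-identityʳ n)) n≤1
⟦⟧*n≤⟦⟧ false _ = z≤n

⟦x⟧*[⟦y⟧+⟦z⟧]≤⟦x⟧+⟦y∧z⟧ : ∀ x y z → ⟦ x ⟧ * (⟦ y ⟧ + ⟦ z ⟧) ≤ ⟦ x ⟧ + ⟦ y ∧ z ⟧
⟦x⟧*[⟦y⟧+⟦z⟧]≤⟦x⟧+⟦y∧z⟧ false y z = z≤n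
⟦x⟧*[⟦y⟧+⟦z⟧]≤⟦x⟧+⟦y∧z⟧ true true true = ≤-refl
⟦x⟧*[⟦y⟧+⟦z⟧]≤⟦x⟧+⟦y∧z⟧ true true false = ≤-refl
⟦x⟧*[⟦y⟧+⟦z⟧]≤⟦x⟧+⟦y∧z⟧ true false true = ≤-refl
⟦x⟧*[⟦y⟧+⟦z⟧]≤⟦x⟧+⟦y∧z⟧ true false false = z≤n

filter-map : {P : A → Set} {Q : B → Set} (P? : Decidable P) (Q? : Decidable Q) {g : B → A} →
  (∀ x → does (P? (g x)) ≡ does (Q? x)) → ∀ xs → filter P? (map g xs) ≡ map g (filter Q? xs)
filter-map P? Q? P∘g≐Q [] = refl
filter-map P? Q? {g} P∘g≐Q (x ∷ xs) with does (P? (g x)) | does (Q? x) | P∘g≐Q x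
... | true | true | _ = cong (g x ∷_) (filter-map P? Q? P∘g≐Q xs)
... | false | false | _ = filter-map P? Q? P∘g≐Q xs

filter-map-reject : {P : A → Set} (P? : Decidable P) {g : B → A} →
  (∀ x → does (P? (g x)) ≡ false) → ∀ xs → filter P? (map g xs) ≡ []
filter-map-reject P? ¬P∘g [] = refl
filter-map-reject P? {g} ¬P∘g (x ∷ xs) with does (P? (g x)) | ¬P∘g x
... | false | _ = filter-map-reject P? ¬P∘g xs

sumSublists : (List A → ℕ) → List A → ℕ
sumSublists w [] = w []
sumSublists w (x ∷ xs) = sumSublists w xs + sumSublists (w ∘ (x ∷_)) xs

sumSublists-cong : {f g : List A → ℕ} → ∀ xs → (∀ a → f a ≡ g a) →
  sumSublists f xs ≡ sumSublists g xs
sumSublists-cong [] f≗g = f≗g []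
sumSublists-cong (x ∷ xs) f≗g = cong₂ _+_ (sumSublists-cong xs f≗g) (sumSublists-cong xs (f≗g ∘ (x ∷_)))

sumSublists-mono : {f g : List A → ℕ} → ∀ xs → (∀ {a} → a ⊆ xs → f a ≤ g a) →
  sumSublists f xs ≤ sumSublists g xs
sumSublists-mono [] f≤g = f≤g []
sumSublists-mono (x ∷ xs) f≤g =
  +-mono-≤ (sumSublists-mono xs (f≤g ∘ (x ∷ʳ_))) (sumSublists-mono xs (f≤g ∘ (refl ∷_)))

sumSublists-+ : (f g : List A → ℕ) → ∀ xs →
  sumSublists (λ a → f a + g a) xs ≡ sumSublists f xs + sumSublists g xs
sumSublists-+ f g [] = refl
sumSublists-+ f g (x ∷ xs) = begin
  sumSublists (λ a → f a + g a) xs + sumSublists (λ a → f (x ∷ a) + g (x ∷ a)) xs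
    ≡⟨ cong₂ _+_ (sumSublists-+ f g xs) (sumSublists-+ (f ∘ (x ∷_)) (g ∘ (x ∷_)) xs) ⟩
  (sumSublists f xs + sumSublists g xs) + (sumSublists (f ∘ (x ∷_)) xs + sumSublists (g ∘ (x ∷_)) xs)
    ≡⟨ +-comm-middle (sumSublists f xs) _ _ _ ⟩
  sumSublists f (x ∷ xs) + sumSublists g (x ∷ xs) ∎
  where
  open ≡-Reasoning
  +-comm-middle : ∀ a b c d → (a + b) + (c + d) ≡ (a + c) + (b + d)
  +-comm-middle = solve-∀

sumSublists-*ˡ : ∀ n (f : List A → ℕ) xs → sumSublists (λ a → n * f a) xs ≡ n * sumSublists f xs
sumSublists-*ˡ n f [] = refl
sumSublists-*ˡ n f (x ∷ xs) =
  trans (cong₂ _+_ (sumSublists-*ˡ n f xs) (sumSublists-*ˡ n (f ∘ (x ∷_)) xs))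
        (sym (*-distribˡ-+ n (sumSublists f xs) _))

sumSublists-*ʳ : ∀ n (f : List A → ℕ) xs → sumSublists (λ a → f a * n) xs ≡ sumSublists f xs * n
sumSublists-*ʳ n f [] = refl
sumSublists-*ʳ n f (x ∷ xs) =
  trans (cong₂ _+_ (sumSublists-*ʳ n f xs) (sumSublists-*ʳ n (f ∘ (x ∷_)) xs))
        (sym (*-distribʳ-+ n (sumSublists f xs) _))

sumSublists-map : (g : A → B) (w : List B → ℕ) → ∀ xs →
  sumSublists w (map g xs) ≡ sumSublists (w ∘ map g) xs
sumSublists-map g w [] = refl
sumSublists-map g w (x ∷ xs) = cong₂ _+_ (sumSublists-map g w xs) (sumSublists-map g (w ∘ (g x ∷_)) xs)

sumSublists-++ : (w : List A → ℕ) → ∀ xs ys →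
  sumSublists w (xs ++ ys) ≡ sumSublists (λ a → sumSublists (λ b → w (a ++ b)) ys) xs
sumSublists-++ w [] ys = refl
sumSublists-++ w (x ∷ xs) ys = cong₂ _+_ (sumSublists-++ w xs ys) (sumSublists-++ (w ∘ (x ∷_)) xs ys)

length-filter-sublists : {P : List A → Set} (P? : Decidable P) → ∀ xs →
  length (filter P? (sublists xs)) ≡ sumSublists (λ a → ⟦ does (P? a) ⟧) xs
length-filter-sublists P? [] with does (P? [])
... | true = refl
... | false = refl
length-filter-sublists P? (x ∷ xs) = begin
  length (filter P? (sublists xs ++ map (x ∷_) (sublists xs)))
    ≡⟨ cong length (filter-++ P? (sublists xs) _) ⟩
  length (filter P? (sublists xs) ++ filter P? (map (x ∷_) (sublists xs)))
    ≡⟨ length-++ (filter P? (sublists xs)) ⟩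
  length (filter P? (sublists xs)) + length (filter P? (map (x ∷_) (sublists xs)))
    ≡⟨ cong (length (filter P? (sublists xs)) +_)
         (trans (cong length (filter-map P? (P? ∘ (x ∷_)) (λ _ → refl) (sublists xs)))
                (length-map (x ∷_) (filter (P? ∘ (x ∷_)) (sublists xs)))) ⟩
  length (filter P? (sublists xs)) + length (filter (P? ∘ (x ∷_)) (sublists xs))
    ≡⟨ cong₂ _+_ (length-filter-sublists P? xs) (length-filter-sublists (P? ∘ (x ∷_)) xs) ⟩
  sumSublists (λ a → ⟦ does (P? a) ⟧) (x ∷ xs) ∎
  where open ≡-Reasoning

subsetsOfSize-0 : ∀ m → subsetsOfSize m 0 ≡ [ ⊥ ]
subsetsOfSize-0 zero = refl
subsetsOfSize-0 (suc m) = begin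
  filter P? (map (outside ∷_) S ++ map (inside ∷_) S)
    ≡⟨ filter-++ P? (map (outside ∷_) S) _ ⟩
  filter P? (map (outside ∷_) S) ++ filter P? (map (inside ∷_) S)
    ≡⟨ cong₂ _++_ (filter-map P? (λ s → ∣ s ∣ ≟ 0) (λ _ → refl) S)
                  (filter-map-reject P? (λ _ → refl) S) ⟩
  map (outside ∷_) (subsetsOfSize m 0) ++ []
    ≡⟨ ++-identityʳ _ ⟩
  map (outside ∷_) (subsetsOfSize m 0)
    ≡⟨ cong (map (outside ∷_)) (subsetsOfSize-0 m) ⟩
  [ ⊥ ] ∎
  where
  open ≡-Reasoning
  S = allSubsets m
  P? = λ (s : Subset (suc m)) → ∣ s ∣ ≟ 0

subsetsOfSize-suc : ∀ m t → subsetsOfSize (suc m) (suc t) ≡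
  map (outside ∷_) (subsetsOfSize m (suc t)) ++ map (inside ∷_) (subsetsOfSize m t)
subsetsOfSize-suc m t = begin
  filter P? (map (outside ∷_) S ++ map (inside ∷_) S)
    ≡⟨ filter-++ P? (map (outside ∷_) S) _ ⟩
  filter P? (map (outside ∷_) S) ++ filter P? (map (inside ∷_) S)
    ≡⟨ cong₂ _++_ (filter-map P? (λ s → ∣ s ∣ ≟ suc t) (λ _ → refl) S)
                  (filter-map P? (λ s → ∣ s ∣ ≟ t) (λ _ → refl) S) ⟩
  map (outside ∷_) (subsetsOfSize m (suc t)) ++ map (inside ∷_) (subsetsOfSize m t) ∎
  where
  open ≡-Reasoning
  S = allSubsets m
  P? = λ (s : Subset (suc m)) → ∣ s ∣ ≟ suc t

spanned-++ : (a b : List (Subset m)) (K : Subset m) → spanned (a ++ b) K ≡ spanned a K + spanned b K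
spanned-++ a b K = trans (cong length (filter-++ (_⊆? K) a b)) (length-++ (filter (_⊆? K) a))

spanned-outside∷ : (a : List (Subset m)) (y : Side) (K : Subset m) →
  spanned (map (outside ∷_) a) (y ∷ K) ≡ spanned a K
spanned-outside∷ a y K =
  trans (cong length (filter-map (_⊆? (y ∷ K)) (_⊆? K) (λ _ → refl) a)) (length-map _ (filter (_⊆? K) a))

spanned-inside∷ : (a : List (Subset m)) (K : Subset m) →
  spanned (map (inside ∷_) a) (inside ∷ K) ≡ spanned a K
spanned-inside∷ a K =
  trans (cong length (filter-map (_⊆? (inside ∷ K)) (_⊆? K) (λ _ → refl) a)) (length-map _ (filter (_⊆? K) a))

spanned-inside∷-outside : (a : List (Subset m)) (K : Subset m) →
  spanned (map (inside ∷_) a) (outside ∷ K) ≡ 0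
spanned-inside∷-outside a K = cong length (filter-map-reject (_⊆? (outside ∷ K)) (λ _ → refl) a)

spanned-⊥ : (K : Subset m) → spanned [ ⊥ ] K ≡ 1
spanned-⊥ K with ⊥ ⊆? K
... | yes _ = refl
... | no ⊥⊈K = ⊥-elim (⊥⊈K ⊥⊆)

spanned-mono : {a b : List (Subset m)} → a ⊆ b → ∀ K → spanned a K ≤ spanned b K
spanned-mono a⊆b K = length-mono-≤ (filter⁺ (_⊆? K) (_⊆? K) (λ { refl → id }) a⊆b)

spanned-extend-outside : (a b : List (Subset m)) (K : Subset m) →
  spanned (map (outside ∷_) a ++ map (inside ∷_) b) (outside ∷ K) ≡ spanned a K
spanned-extend-outside a b K = begin
  spanned (map (outside ∷_) a ++ map (inside ∷_) b) (outside ∷ K)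
    ≡⟨ spanned-++ (map (outside ∷_) a) (map (inside ∷_) b) (outside ∷ K) ⟩
  spanned (map (outside ∷_) a) (outside ∷ K) + spanned (map (inside ∷_) b) (outside ∷ K)
    ≡⟨ cong₂ _+_ (spanned-outside∷ a outside K) (spanned-inside∷-outside b K) ⟩
  spanned a K + 0
    ≡⟨ +-identityʳ (spanned a K) ⟩
  spanned a K ∎
  where open ≡-Reasoning

spanned-extend-inside : (a b : List (Subset m)) (K : Subset m) →
  spanned (map (outside ∷_) a ++ map (inside ∷_) b) (inside ∷ K) ≡ spanned a K + spanned b K
spanned-extend-inside a b K = trans (spanned-++ (map (outside ∷_) a) (map (inside ∷_) b) (inside ∷ K))
  (cong₂ _+_ (spanned-outside∷ a inside K) (spanned-inside∷ b K))

spanned-complete : ∀ m r (K : Subset m) → spanned (subsetsOfSize m r) K ≡ ∣ K ∣ C r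
spanned-complete m zero K = trans (cong (λ G → spanned G K) (subsetsOfSize-0 m)) (spanned-⊥ K)
spanned-complete zero (suc r) [] = refl
spanned-complete (suc m) (suc r) (outside ∷ K) = begin
  spanned (subsetsOfSize (suc m) (suc r)) (outside ∷ K)
    ≡⟨ cong (λ G → spanned G (outside ∷ K)) (subsetsOfSize-suc m r) ⟩
  spanned (map (outside ∷_) (subsetsOfSize m (suc r)) ++ map (inside ∷_) (subsetsOfSize m r)) (outside ∷ K)
    ≡⟨ spanned-extend-outside (subsetsOfSize m (suc r)) (subsetsOfSize m r) K ⟩
  spanned (subsetsOfSize m (suc r)) K
    ≡⟨ spanned-complete m (suc r) K ⟩
  ∣ K ∣ C suc r ∎
  where open ≡-Reasoning
spanned-complete (suc m) (suc r) (inside ∷ K) = begin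
  spanned (subsetsOfSize (suc m) (suc r)) (inside ∷ K)
    ≡⟨ cong (λ G → spanned G (inside ∷ K)) (subsetsOfSize-suc m r) ⟩
  spanned (map (outside ∷_) (subsetsOfSize m (suc r)) ++ map (inside ∷_) (subsetsOfSize m r)) (inside ∷ K)
    ≡⟨ spanned-extend-inside (subsetsOfSize m (suc r)) (subsetsOfSize m r) K ⟩
  spanned (subsetsOfSize m (suc r)) K + spanned (subsetsOfSize m r) K
    ≡⟨ cong₂ _+_ (spanned-complete m (suc r) K) (spanned-complete m r K) ⟩
  ∣ K ∣ C suc r + ∣ K ∣ C r
    ≡⟨ +-comm (∣ K ∣ C suc r) _ ⟩
  ∣ K ∣ C r + ∣ K ∣ C suc r
    ≡⟨ nCk+nC[k+1]≡[n+1]C[k+1] ∣ K ∣ r ⟩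
  suc ∣ K ∣ C suc r ∎
  where open ≡-Reasoning

spanned-≤ : ∀ {m r} {a : List (Subset m)} → a ⊆ subsetsOfSize m r → ∀ K → spanned a K ≤ ∣ K ∣ C r
spanned-≤ {m} {r} a⊆ K = ≤-trans (spanned-mono a⊆ K) (≤-reflexive (spanned-complete m r K))

all-++ : (p : A → Bool) → ∀ xs ys → all p (xs ++ ys) ≡ all p xs ∧ all p ys
all-++ p [] ys = refl
all-++ p (x ∷ xs) ys = trans (cong (p x ∧_) (all-++ p xs ys)) (sym (∧-assoc (p x) (all p xs) (all p ys)))

all-map : (p : A → Bool) (g : B → A) → ∀ xs → all p (map g xs) ≡ all (p ∘ g) xs
all-map p g [] = refl
all-map p g (x ∷ xs) = cong (p (g x) ∧_) (all-map p g xs)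

all-cong : {p q : A → Bool} → ∀ xs → (∀ x → p x ≡ q x) → all p xs ≡ all q xs
all-cong [] p≗q = refl
all-cong (x ∷ xs) p≗q = cong₂ _∧_ (p≗q x) (all-cong xs p≗q)

all-∧ : (p q : A → Bool) → ∀ xs → all p xs ∧ all q xs ≡ all (λ x → p x ∧ q x) xs
all-∧ p q [] = refl
all-∧ p q (x ∷ xs) with p x | q x
... | false | _ = refl
... | true | false = ∧-zeroʳ (all p xs)
... | true | true = all-∧ p q xs

all-subsetsOfSize-0 : (p : Subset m → Bool) → all p (subsetsOfSize m 0) ≡ p ⊥
all-subsetsOfSize-0 {m} p = trans (cong (all p) (subsetsOfSize-0 m)) (∧-identityʳ (p ⊥))

all-subsetsOfSize-suc : ∀ t (p : Subset (suc m) → Bool) → all p (subsetsOfSize (suc m) (suc t)) ≡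
  all (p ∘ (outside ∷_)) (subsetsOfSize m (suc t)) ∧ all (p ∘ (inside ∷_)) (subsetsOfSize m t)
all-subsetsOfSize-suc {m} t p = begin
  all p (subsetsOfSize (suc m) (suc t))
    ≡⟨ cong (all p) (subsetsOfSize-suc m t) ⟩
  all p (map (outside ∷_) (subsetsOfSize m (suc t)) ++ map (inside ∷_) (subsetsOfSize m t))
    ≡⟨ all-++ p (map (outside ∷_) (subsetsOfSize m (suc t))) _ ⟩
  all p (map (outside ∷_) (subsetsOfSize m (suc t))) ∧ all p (map (inside ∷_) (subsetsOfSize m t))
    ≡⟨ cong₂ _∧_ (all-map p (outside ∷_) (subsetsOfSize m (suc t)))
                 (all-map p (inside ∷_) (subsetsOfSize m t)) ⟩
  all (p ∘ (outside ∷_)) (subsetsOfSize m (suc t)) ∧ all (p ∘ (inside ∷_)) (subsetsOfSize m t) ∎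
  where open ≡-Reasoning

-- c K counts the edges inside K that were fixed by vertices deleted earlier.
isFree : ∀ m t → (Subset m → ℕ) → (ℕ → Bool) → List (Subset m) → Bool
isFree m t c F H = all (λ K → not (F (c K + spanned H K))) (subsetsOfSize m t)

countFree : ∀ m r t → (Subset m → ℕ) → (ℕ → Bool) → ℕ
countFree m r t c F = sumSublists (λ H → ⟦ isFree m t c F H ⟧) (subsetsOfSize m r)

linkOffset : (Subset (suc m) → ℕ) → List (Subset m) → Subset m → ℕ
linkOffset c a K = c (inside ∷ K) + spanned a K

widen : (ℕ → Bool) → ℕ → Bool
widen F v = F v ∨ F (suc v)

isFree-split : ∀ m t (c : Subset (suc m) → ℕ) F (a b : List (Subset m)) →
  isFree (suc m) (suc t) c F (map (outside ∷_) a ++ map (inside ∷_) b) ≡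
  isFree m (suc t) (c ∘ (outside ∷_)) F a ∧ isFree m t (linkOffset c a) F b
isFree-split m t c F a b = trans (all-subsetsOfSize-suc t freeAt)
  (cong₂ _∧_ (all-cong (subsetsOfSize m (suc t)) outerSets) (all-cong (subsetsOfSize m t) innerSets))
  where
  freeAt : Subset (suc m) → Bool
  freeAt K = not (F (c K + spanned (map (outside ∷_) a ++ map (inside ∷_) b) K))
  outerSets : ∀ K → freeAt (outside ∷ K) ≡ not (F (c (outside ∷ K) + spanned a K))
  outerSets K = cong (λ e → not (F (c (outside ∷ K) + e))) (spanned-extend-outside a b K)
  innerSets : ∀ K → freeAt (inside ∷ K) ≡ not (F (linkOffset c a K + spanned b K))
  innerSets K = cong (not ∘ F) (trans (cong (c (inside ∷ K) +_) (spanned-extend-inside a b K))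
                                      (sym (+-assoc (c (inside ∷ K)) (spanned a K) (spanned b K))))

isFree-0 : ∀ m c F (H : List (Subset m)) → isFree m 0 c F H ≡ not (F (c ⊥ + spanned H ⊥))
isFree-0 m c F H = all-subsetsOfSize-0 (λ K → not (F (c K + spanned H K)))

isFree-widen : ∀ m t c F (H : List (Subset m)) →
  isFree m t c F H ∧ isFree m t (suc ∘ c) F H ≡ isFree m t c (widen F) H
isFree-widen m t c F H = trans (all-∧ _ _ (subsetsOfSize m t))
  (all-cong (subsetsOfSize m t) λ K → not-∧-not (F (c K + spanned H K)) _)
  where
  not-∧-not : ∀ x y → not x ∧ not y ≡ not (x ∨ y)
  not-∧-not true y = refl
  not-∧-not false y = refl

countFree-suc : ∀ m r t c F → countFree (suc m) (suc r) (suc t) c F ≡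
  sumSublists (λ a → ⟦ isFree m (suc t) (c ∘ (outside ∷_)) F a ⟧ * countFree m r t (linkOffset c a) F)
              (subsetsOfSize m (suc r))
countFree-suc m r t c F = begin
  sumSublists w (subsetsOfSize (suc m) (suc r))
    ≡⟨ cong (sumSublists w) (subsetsOfSize-suc m r) ⟩
  sumSublists w (map (outside ∷_) Eₒ ++ map (inside ∷_) Eᵢ)
    ≡⟨ sumSublists-++ w (map (outside ∷_) Eₒ) (map (inside ∷_) Eᵢ) ⟩
  sumSublists (λ a → sumSublists (λ b → w (a ++ b)) (map (inside ∷_) Eᵢ)) (map (outside ∷_) Eₒ)
    ≡⟨ sumSublists-map (outside ∷_) _ Eₒ ⟩
  sumSublists (λ a → sumSublists (λ b → w (map (outside ∷_) a ++ b)) (map (inside ∷_) Eᵢ)) Eₒ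
    ≡⟨ sumSublists-cong Eₒ (λ a → sumSublists-map (inside ∷_) _ Eᵢ) ⟩
  sumSublists (λ a → sumSublists (λ b → w (map (outside ∷_) a ++ map (inside ∷_) b)) Eᵢ) Eₒ
    ≡⟨ sumSublists-cong Eₒ (λ a → sumSublists-cong Eᵢ λ b →
         trans (cong ⟦_⟧ (isFree-split m t c F a b)) (⟦∧⟧≡⟦⟧*⟦⟧ (outerFree a) _)) ⟩
  sumSublists (λ a → sumSublists (λ b → ⟦ outerFree a ⟧ * ⟦ isFree m t (linkOffset c a) F b ⟧) Eᵢ) Eₒ
    ≡⟨ sumSublists-cong Eₒ (λ a → sumSublists-*ˡ ⟦ outerFree a ⟧ _ Eᵢ) ⟩
  sumSublists (λ a → ⟦ outerFree a ⟧ * countFree m r t (linkOffset c a) F) Eₒ ∎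
  where
  open ≡-Reasoning
  w = λ H → ⟦ isFree (suc m) (suc t) c F H ⟧
  Eₒ = subsetsOfSize m (suc r)
  Eᵢ = subsetsOfSize m r
  outerFree = isFree m (suc t) (c ∘ (outside ∷_)) F

countFree-link-0 : ∀ m t (c : Subset (suc m) → ℕ) F a → countFree m 0 t (linkOffset c a) F ≡
  ⟦ isFree m t (c ∘ (inside ∷_)) F a ⟧ + ⟦ isFree m t (suc ∘ c ∘ (inside ∷_)) F a ⟧
countFree-link-0 m t c F a rewrite subsetsOfSize-0 m = cong₂ _+_
  (cong ⟦_⟧ (all-cong (subsetsOfSize m t) λ K → cong (not ∘ F) (+-identityʳ (linkOffset c a K))))
  (cong ⟦_⟧ (all-cong (subsetsOfSize m t) λ K → cong (not ∘ F)
    (trans (cong (linkOffset c a K +_) (spanned-⊥ K)) (+-comm (linkOffset c a K) 1))))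

1+m*2^s≤2^[2k]*n : ∀ {m n s k} .{{_ : NonZero n}} → m ≤ n → s + 2 ≤ k → 1 + m * 2 ^ s ≤ 2 ^ (2 * k) * n
1+m*2^s≤2^[2k]*n {m} {n} {s} {k} m≤n s+2≤k = begin
  1 + m * 2 ^ s
    ≤⟨ +-mono-≤ (≤-trans (>-nonZero⁻¹ n) (m≤m*n n (2 ^ k) {{m^n≢0 2 k}}))
                (*-mono-≤ m≤n (^-monoʳ-≤ 2 s≤k)) ⟩
  n * 2 ^ k + n * 2 ^ k
    ≡⟨ double n (2 ^ k) ⟩
  2 ^ suc k * n
    ≤⟨ *-monoˡ-≤ n (^-monoʳ-≤ 2 1+k≤2k) ⟩
  2 ^ (2 * k) * n ∎
  where
  open ≤-Reasoning
  double : ∀ a b → a * b + a * b ≡ 2 * b * a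
  double = solve-∀
  s≤k : s ≤ k
  s≤k = ≤-trans (m≤m+n s 2) s+2≤k
  1≤k : 1 ≤ k
  1≤k = ≤-trans (s≤s z≤n) (≤-trans (m≤n+m 2 s) s+2≤k)
  1+k≤2k : suc k ≤ 2 * k
  1+k≤2k = subst (_≤ 2 * k) (+-comm k 1) (+-monoʳ-≤ k (subst (1 ≤_) (sym (+-identityʳ k)) 1≤k))

m^[1+r]+m^r≤[1+m]^[1+r] : ∀ m r → m ^ suc r + m ^ r ≤ suc m ^ suc r
m^[1+r]+m^r≤[1+m]^[1+r] m r = begin
  m * m ^ r + m ^ r
    ≡⟨ +-comm (m * m ^ r) (m ^ r) ⟩
  m ^ r + m * m ^ r
    ≤⟨ +-mono-≤ (^-monoˡ-≤ r (n≤1+n m)) (*-monoʳ-≤ m (^-monoˡ-≤ r (n≤1+n m))) ⟩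
  suc m ^ r + m * suc m ^ r ∎
  where open ≤-Reasoning

[m*n]^k≡m^k*n^k : ∀ m n k → (m * n) ^ k ≡ m ^ k * n ^ k
[m*n]^k≡m^k*n^k m n zero = refl
[m*n]^k≡m^k*n^k m n (suc k) = trans (cong (m * n *_) ([m*n]^k≡m^k*n^k m n k)) (interchange m n (m ^ k) (n ^ k))
  where
  interchange : ∀ a b x y → a * b * (x * y) ≡ a * x * (b * y)
  interchange = solve-∀

ThreeDense : (ℕ → Bool) → ℕ → Set
ThreeDense F N = ∀ d → d + 2 ≤ N → F d ∨ F (suc d) ∨ F (suc (suc d)) ≡ true

module _ {F : ℕ → Bool} {N : ℕ} (dense : ThreeDense F N) where

  widen-free-≤1 : ∀ x → x + 2 ≤ N → ⟦ not (widen F x) ⟧ + ⟦ not (widen F (suc x)) ⟧ ≤ 1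
  widen-free-≤1 x x+2≤N with F x | F (suc x) | F (suc (suc x)) | dense x x+2≤N
  ... | true | _ | _ | _ = ⟦⟧≤1 _
  ... | false | true | _ | _ = z≤n
  ... | false | false | true | _ = ≤-refl

  countFree-1-widen-≤ : ∀ m t (c : Subset m → ℕ) → (∀ K → ∣ K ∣ ≡ suc t → c K + suc t < N) →
    countFree m 1 (suc t) c (widen F) ≤ 2 ^ t
  countFree-1-widen-≤ zero t c _ = ≤-trans (⟦⟧≤1 _) (m^n>0 2 t)
  countFree-1-widen-≤ (suc m) zero c bound = begin
    countFree (suc m) 1 1 c (widen F)
      ≡⟨ countFree-suc m 0 0 c (widen F) ⟩
    sumSublists (λ a → ⟦ outerFree a ⟧ * countFree m 0 0 (linkOffset c a) (widen F)) (subsetsOfSize m 1)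
      ≤⟨ sumSublists-mono (subsetsOfSize m 1) (λ {a} a⊆ → ⟦⟧*n≤⟦⟧ (outerFree a) (linkCount≤1 a⊆)) ⟩
    countFree m 1 1 (c ∘ (outside ∷_)) (widen F)
      ≤⟨ countFree-1-widen-≤ m 0 (c ∘ (outside ∷_)) (bound ∘ (outside ∷_)) ⟩
    1 ∎
    where
    open ≤-Reasoning
    outerFree = isFree m 1 (c ∘ (outside ∷_)) (widen F)
    linkCount≤1 : ∀ {a} → a ⊆ subsetsOfSize m 1 → countFree m 0 0 (linkOffset c a) (widen F) ≤ 1
    linkCount≤1 {a} a⊆ = begin
      countFree m 0 0 (linkOffset c a) (widen F)
        ≡⟨ countFree-link-0 m 0 c (widen F) a ⟩
      ⟦ isFree m 0 cᵢ (widen F) a ⟧ + ⟦ isFree m 0 (suc ∘ cᵢ) (widen F) a ⟧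
        ≡⟨ cong₂ _+_ (cong ⟦_⟧ (isFree-0 m _ (widen F) a)) (cong ⟦_⟧ (isFree-0 m _ (widen F) a)) ⟩
      ⟦ not (widen F x) ⟧ + ⟦ not (widen F (suc x)) ⟧
        ≤⟨ widen-free-≤1 x x+2≤N ⟩
      1 ∎
      where
      cᵢ = c ∘ (inside ∷_)
      x = cᵢ ⊥ + spanned a ⊥
      noEdgeIn⊥ : spanned a ⊥ ≡ 0
      noEdgeIn⊥ = n≤0⇒n≡0 (subst (λ s → spanned a ⊥ ≤ s C 1) (∣⊥∣≡0 m) (spanned-≤ a⊆ ⊥))
      x+2≤N : x + 2 ≤ N
      x+2≤N = subst (λ e → c (inside ∷ ⊥) + e + 2 ≤ N) (sym noEdgeIn⊥)
        (≤-trans (≤-reflexive (shift (c (inside ∷ ⊥)))) (bound (inside ∷ ⊥) (cong suc (∣⊥∣≡0 m))))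
        where
        shift : ∀ y → y + 0 + 2 ≡ suc (y + 1)
        shift = solve-∀
  countFree-1-widen-≤ (suc m) (suc t) c bound = begin
    countFree (suc m) 1 (suc (suc t)) c (widen F)
      ≡⟨ countFree-suc m 0 (suc t) c (widen F) ⟩
    sumSublists (λ a → ⟦ outerFree a ⟧ * countFree m 0 (suc t) (linkOffset c a) (widen F)) E
      ≤⟨ sumSublists-mono E (λ {a} _ → ⟦⟧*n≤n (outerFree a) _) ⟩
    sumSublists (λ a → countFree m 0 (suc t) (linkOffset c a) (widen F)) E
      ≡⟨ sumSublists-cong E (countFree-link-0 m (suc t) c (widen F)) ⟩
    sumSublists (λ a → ⟦ linkFree a ⟧ + ⟦ linkFree⁺ a ⟧) E
      ≡⟨ sumSublists-+ _ _ E ⟩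
    countFree m 1 (suc t) cᵢ (widen F) + countFree m 1 (suc t) (suc ∘ cᵢ) (widen F)
      ≤⟨ +-mono-≤
           (countFree-1-widen-≤ m t cᵢ λ K e → ≤-<-trans (+-monoʳ-≤ (cᵢ K) (n≤1+n (suc t))) (boundᵢ K e))
           (countFree-1-widen-≤ m t (suc ∘ cᵢ) λ K e → subst (_< N) (+-suc (cᵢ K) (suc t)) (boundᵢ K e)) ⟩
    2 ^ t + 2 ^ t
      ≡⟨ cong (2 ^ t +_) (sym (+-identityʳ (2 ^ t))) ⟩
    2 ^ suc t ∎
    where
    open ≤-Reasoning
    E = subsetsOfSize m 1
    outerFree = isFree m (suc (suc t)) (c ∘ (outside ∷_)) (widen F)
    cᵢ = c ∘ (inside ∷_)
    linkFree = isFree m (suc t) cᵢ (widen F)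
    linkFree⁺ = isFree m (suc t) (suc ∘ cᵢ) (widen F)
    boundᵢ : ∀ K → ∣ K ∣ ≡ suc t → cᵢ K + suc (suc t) < N
    boundᵢ K e = bound (inside ∷ K) (cong suc e)

  countFree-1-≤ : ∀ m s (c : Subset m → ℕ) →
    (∀ K → ∣ K ∣ ≡ suc (suc s) → c K + suc (suc s) ≤ N) → countFree m 1 (suc (suc s)) c F ≤ 1 + m * 2 ^ s
  countFree-1-≤ zero s c _ = ⟦⟧≤1 _
  countFree-1-≤ (suc m) s c bound = begin
    countFree (suc m) 1 (suc (suc s)) c F
      ≡⟨ countFree-suc m 0 (suc s) c F ⟩
    sumSublists (λ a → ⟦ outerFree a ⟧ * countFree m 0 (suc s) (linkOffset c a) F) E
      ≡⟨ sumSublists-cong E (λ a → cong (⟦ outerFree a ⟧ *_) (countFree-link-0 m (suc s) c F a)) ⟩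
    sumSublists (λ a → ⟦ outerFree a ⟧ * (⟦ linkFree a ⟧ + ⟦ linkFree⁺ a ⟧)) E
      ≤⟨ sumSublists-mono E (λ {a} _ →
           ⟦x⟧*[⟦y⟧+⟦z⟧]≤⟦x⟧+⟦y∧z⟧ (outerFree a) (linkFree a) (linkFree⁺ a)) ⟩
    sumSublists (λ a → ⟦ outerFree a ⟧ + ⟦ linkFree a ∧ linkFree⁺ a ⟧) E
      ≡⟨ sumSublists-cong E (λ a →
           cong (λ v → ⟦ outerFree a ⟧ + ⟦ v ⟧) (isFree-widen m (suc s) cᵢ F a)) ⟩
    sumSublists (λ a → ⟦ outerFree a ⟧ + ⟦ isFree m (suc s) cᵢ (widen F) a ⟧) E
      ≡⟨ sumSublists-+ _ _ E ⟩
    countFree m 1 (suc (suc s)) (c ∘ (outside ∷_)) F + countFree m 1 (suc s) cᵢ (widen F)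
      ≤⟨ +-mono-≤ (countFree-1-≤ m s (c ∘ (outside ∷_)) (bound ∘ (outside ∷_)))
                  (countFree-1-widen-≤ m s cᵢ λ K e →
                    subst (_≤ N) (+-suc (cᵢ K) (suc s)) (bound (inside ∷ K) (cong suc e))) ⟩
    1 + m * 2 ^ s + 2 ^ s
      ≡⟨ cong suc (+-comm (m * 2 ^ s) (2 ^ s)) ⟩
    1 + suc m * 2 ^ s ∎
    where
    open ≤-Reasoning
    E = subsetsOfSize m 1
    cᵢ = c ∘ (inside ∷_)
    outerFree = isFree m (suc (suc s)) (c ∘ (outside ∷_)) F
    linkFree = isFree m (suc s) cᵢ F
    linkFree⁺ = isFree m (suc s) (suc ∘ cᵢ) F

  module _ (n k : ℕ) .{{_ : NonZero n}} where

    private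
      D : ℕ
      D = 2 ^ (2 * k) * n

      instance
        D≢0 : NonZero D
        D≢0 = m*n≢0 (2 ^ (2 * k)) n {{m^n≢0 2 (2 * k)}}

    countFree-≤ : ∀ r m t (c : Subset m → ℕ) → m ≤ n → t ≤ k → 2 + r ≤ t →
      (∀ K → ∣ K ∣ ≡ t → c K + t C suc r ≤ N) →
      countFree m (suc r) t c F ≤ (2 ^ (2 * k) * n) ^ (m ^ r)
    countFree-≤ zero m (suc (suc s)) c m≤n t≤k _ bound =
      ≤-trans (countFree-1-≤ m s c bound₁)
        (≤-trans (1+m*2^s≤2^[2k]*n m≤n (subst (_≤ k) (+-comm 2 s) t≤k))
                 (≤-reflexive (sym (^-identityʳ D))))
      where
      bound₁ : ∀ K → ∣ K ∣ ≡ suc (suc s) → c K + suc (suc s) ≤ N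
      bound₁ K e = subst (λ b → c K + b ≤ N) (nC1≡n (suc (suc s))) (bound K e)
    countFree-≤ zero m (suc zero) c _ _ (s≤s ()) _
    countFree-≤ (suc r) zero t c _ _ _ _ = ⟦⟧≤1 _
    countFree-≤ (suc r) (suc m) (suc t) c m+1≤n t+1≤k (s≤s r+2≤t) bound = begin
      countFree (suc m) (suc (suc r)) (suc t) c F
        ≡⟨ countFree-suc m (suc r) t c F ⟩
      sumSublists (λ a → ⟦ outerFree a ⟧ * countFree m (suc r) t (linkOffset c a) F) E
        ≤⟨ sumSublists-mono E (λ {a} a⊆ → *-monoʳ-≤ ⟦ outerFree a ⟧
             (countFree-≤ r m t (linkOffset c a) m≤n (≤-trans (n≤1+n t) t+1≤k) r+2≤t (linkBound a⊆))) ⟩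
      sumSublists (λ a → ⟦ outerFree a ⟧ * D ^ (m ^ r)) E
        ≡⟨ sumSublists-*ʳ (D ^ (m ^ r)) (⟦_⟧ ∘ outerFree) E ⟩
      countFree m (suc (suc r)) (suc t) (c ∘ (outside ∷_)) F * D ^ (m ^ r)
        ≤⟨ *-monoˡ-≤ (D ^ (m ^ r))
             (countFree-≤ (suc r) m (suc t) (c ∘ (outside ∷_)) m≤n t+1≤k (s≤s r+2≤t)
                          (bound ∘ (outside ∷_))) ⟩
      D ^ (m ^ suc r) * D ^ (m ^ r)
        ≡⟨ ^-distribˡ-+-* D (m ^ suc r) (m ^ r) ⟨
      D ^ (m ^ suc r + m ^ r)
        ≤⟨ ^-monoʳ-≤ D (m^[1+r]+m^r≤[1+m]^[1+r] m r) ⟩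
      D ^ (suc m ^ suc r) ∎
      where
      open ≤-Reasoning
      E = subsetsOfSize m (suc (suc r))
      outerFree = isFree m (suc t) (c ∘ (outside ∷_)) F
      m≤n : m ≤ n
      m≤n = ≤-trans (n≤1+n m) m+1≤n
      linkBound : ∀ {a} → a ⊆ E → ∀ K → ∣ K ∣ ≡ t → linkOffset c a K + t C suc r ≤ N
      linkBound {a} a⊆ K e = begin
        c (inside ∷ K) + spanned a K + t C suc r
          ≡⟨ +-assoc (c (inside ∷ K)) (spanned a K) _ ⟩
        c (inside ∷ K) + (spanned a K + t C suc r)
          ≤⟨ +-monoʳ-≤ (c (inside ∷ K)) (+-monoˡ-≤ (t C suc r) linkEdges) ⟩
        c (inside ∷ K) + (t C suc (suc r) + t C suc r)
          ≡⟨ cong (c (inside ∷ K) +_)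
               (trans (+-comm (t C suc (suc r)) _) (nCk+nC[k+1]≡[n+1]C[k+1] t (suc r))) ⟩
        c (inside ∷ K) + suc t C suc (suc r)
          ≤⟨ bound (inside ∷ K) (cong suc e) ⟩
        N ∎
        where
        linkEdges : spanned a K ≤ t C suc (suc r)
        linkEdges = subst (λ x → spanned a K ≤ x C suc (suc r)) e (spanned-≤ a⊆ K)

_∈ᵇ_ : ℕ → List ℕ → Bool
v ∈ᵇ L = does (v ∈? L)

does-all? : {P : A → Set} (P? : Decidable P) → ∀ xs → does (all? P? xs) ≡ all (does ∘ P?) xs
does-all? P? [] = refl
does-all? P? (x ∷ xs) = cong (does (P? x) ∧_) (does-all? P? xs)

f≡countFree : ∀ n r k L → f n r k L ≡ countFree n r k (λ _ → 0) (_∈ᵇ L)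
f≡countFree n r k L = trans (length-filter-sublists (LkFree? L k) (subsetsOfSize n r))
  (sumSublists-cong (subsetsOfSize n r) λ G →
    cong ⟦_⟧ (does-all? (λ K → ¬? (spanned G K ∈? L)) (subsetsOfSize n k)))

ThreeGood⇒ThreeDense : ∀ k r L → ThreeGood k r L → ThreeDense (_∈ᵇ L) (k C r)
ThreeGood⇒ThreeDense k r L good d d+2≤ with good d d+2≤
... | inj₁ d∈L rewrite dec-true (d ∈? L) d∈L = refl
... | inj₂ (inj₁ d+1∈L) rewrite dec-true (suc d ∈? L) d+1∈L = ∨-zeroʳ (does (d ∈? L))
... | inj₂ (inj₂ d+2∈L) rewrite dec-true (suc (suc d) ∈? L) d+2∈L =
  trans (cong (does (d ∈? L) ∨_) (∨-zeroʳ (does (suc d ∈? L)))) (∨-zeroʳ (does (d ∈? L)))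

theorem1p4 : (n r k : ℕ) (L : List ℕ) → 2 ≤ r → r < k → k ≤ n →
    ListIn k r L → ThreeGood k r L →
    f n r k L ≤ 2 ^ (2 * k * n ^ (r ∸ 1)) * n ^ (n ^ (r ∸ 1))
theorem1p4 n (suc r) k L _ r<k k≤n _ good = begin
  f n (suc r) k L
    ≡⟨ f≡countFree n (suc r) k L ⟩
  countFree n (suc r) k (λ _ → 0) (_∈ᵇ L)
    ≤⟨ countFree-≤ {F = _∈ᵇ L} (ThreeGood⇒ThreeDense k (suc r) L good) n k {{n≢0}}
                   r n k (λ _ → 0) ≤-refl ≤-refl r<k (λ _ _ → ≤-refl) ⟩
  (2 ^ (2 * k) * n) ^ (n ^ r)
    ≡⟨ [m*n]^k≡m^k*n^k (2 ^ (2 * k)) n (n ^ r) ⟩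
  (2 ^ (2 * k)) ^ (n ^ r) * n ^ (n ^ r)
    ≡⟨ cong (_* n ^ (n ^ r)) (^-*-assoc 2 (2 * k) (n ^ r)) ⟩
  2 ^ (2 * k * n ^ r) * n ^ (n ^ r) ∎
  where
  open ≤-Reasoning
  n≢0 : NonZero n
  n≢0 = >-nonZero (≤-trans (≤-trans (s≤s z≤n) r<k) k≤n)
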